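{- For every $m \geq 0$ and $n \geq 0$, the $m$-th iterate of the Thue--Morse transform satisfies \[ a_m(n) \;=\; \bigoplus_{\substack{p\geq 0 \\ p\,\mathbin{\&}\,m = 0}} b_p(n), \] where $\bigoplus$ denotes the XOR (addition modulo~$2$) and $\&$ the bitwise AND.
   Context: For $n\ge 0$ write $n=\sum_{p\ge 0} b_p(n)2^p$ with $b_p(n)=\lfloor n/2^p\rfloor \bmod 2$, and $s_2(n)=\sum_p b_p(n)$. The Thue--Morse sequence is $t(n)=s_2(n)\bmod 2$. For a binary sequence $\sigma\colon\mathbb N\to\{0,1\}$ with $\sigma(0)=0$, $\sigma(1)=1$, taking each value infinitely often, let $v_\sigma(n)$ (resp. $u_\sigma(n)$) be the increasing enumeration of positions where $\sigma=0$ (resp. $\sigma=1$). The Thue--Morse transform $\tau=\mathcal T(\sigma)$ is the unique binary sequence with $\tau(v_\sigma(n))=\tau(n)$, $\tau(u_\sigma(n))=1-\tau(n)$, $\tau(0)=0$. The iterated tower is defined by $a_0=t$ (the Thue--Morse sequence) and $a_{m+1}=\mathcal T(a_m)$ for $m\ge 0$. -}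

module Defs where

open import Data.Nat using (ℕ; zero; suc; _+_; _*_; _^_; _≡ᵇ_)
open import Data.Nat.DivMod using (_/_; _%_)
open import Data.Nat.Properties using (m^n≢0)
open import Data.Bool using (Bool; true; false; not; _xor_; _∧_; if_then_else_)
open import Data.Product using (_×_)
open import Relation.Binary.PropositionalEquality using (_≡_)

bitℕ : ℕ → ℕ → ℕ
bitℕ p n = (_/_ n (2 ^ p) ⦃ m^n≢0 2 p ⦄) % 2

bit : ℕ → ℕ → Bool
bit p n = bitℕ p n ≡ᵇ 1

-- s_2(n) = Σ_p b_p(n); bits with p ≥ n vanish (2^p > n), so p < n suffices.
sumBelow : ℕ → (ℕ → ℕ) → ℕ
sumBelow zero    f = 0
sumBelow (suc k) f = sumBelow k f + f k

s2 : ℕ → ℕ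
s2 n = sumBelow (suc n) (λ p → bitℕ p n)

t : ℕ → Bool
t n = (s2 n % 2) ≡ᵇ 1

-- bitwise AND: m & n = Σ_q 2^q b_q(m) b_q(n); bits of m at positions q > m vanish.
_&_ : ℕ → ℕ → ℕ
m & n = sumBelow (suc m) (λ q → 2 ^ q * (bitℕ q m * bitℕ q n))

xorBelow : ℕ → (ℕ → Bool) → Bool
xorBelow zero    f = false
xorBelow (suc k) f = xorBelow k f xor f k

-- ⊕_{p ≥ 0, p & m = 0} b_p(n).  Terms with p ≥ n vanish, so p ≤ n suffices.
xorFormula : ℕ → ℕ → Bool
xorFormula m n = xorBelow (suc n) (λ p → if (p & m) ≡ᵇ 0 then bit p n else false)

eqB : Bool → Bool → Bool
eqB x y = not (x xor y)

countBefore : (ℕ → Bool) → Bool → ℕ → ℕ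
countBefore σ b zero    = 0
countBefore σ b (suc k) = countBefore σ b k + (if eqB (σ k) b then 1 else 0)

-- Thue–Morse transform, as a relation: τ = T(σ).
-- v_σ(n) = k  iff  σ k = 0 and n = #{i<k : σ i = 0};  likewise for u_σ with 1.
-- So  τ(v_σ(n)) = τ(n), τ(u_σ(n)) = 1 - τ(n)  reads as below.
IsTMTransform : (ℕ → Bool) → (ℕ → Bool) → Set
IsTMTransform σ τ =
  (τ 0 ≡ false)
  × (∀ k → σ k ≡ false → τ k ≡ τ (countBefore σ false k))
  × (∀ k → σ k ≡ true  → τ k ≡ not (τ (countBefore σ true k)))

IsTower : (ℕ → ℕ → Bool) → Set
IsTower a = (∀ n → a 0 n ≡ t n) × (∀ m → IsTMTransform (a m) (a (suc m)))

-- Write Fₘ(n) for the right-hand side.  The condition p & m = 0 says that C(p + m, p) is odd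
-- (Lucas), so it obeys Pascal's rule mod 2; this is checked directly from the binary expansions of
-- p and m.  Summed over the bits of k, Pascal's rule gives F_{m+1}(k) = F_{m+1}(⌊k/2⌋) ⊕ Fₘ(k).
-- Bit 0 is always selected, so Fₘ(2c+1) ≠ Fₘ(2c): each pair {2c, 2c+1} holds one 0 and one 1, hence
-- exactly ⌊k/2⌋ of the positions before k carry the value Fₘ(k), and τ = 𝒯(Fₘ) becomes the
-- recurrence τ(k) = τ(⌊k/2⌋) ⊕ Fₘ(k), τ(0) = 0.  It has exactly one solution, by strong induction
-- on k, so the tower exists and is unique, starting from F₀ = t.

module Submission where

open import Defs
open import Algebra.Bundles using (CommutativeRing)
open import Data.Bool using (Bool; true; false; not; _xor_; if_then_else_)
open import Data.Bool.Properties
  using (xor-assoc; xor-comm; xor-identityʳ; xor-same; not-distribˡ-xor;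
         xor-∧-commutativeRing; if-eta; if-cong; if-cong-then)
open import Algebra.Properties.CommutativeSemigroup
  (CommutativeRing.+-commutativeSemigroup xor-∧-commutativeRing)
  using (interchange; x∙yz≈y∙xz)
open import Data.Nat using (ℕ; zero; suc; _+_; _*_; _^_; _≡ᵇ_; _≤_; _<_; z≤n; s≤s; z<s; s<s)
open import Data.Nat.DivMod
open import Data.Nat.Divisibility using (divides-refl)
open import Data.Nat.Induction using (<-rec)
open import Data.Nat.Properties
open import Data.Product using (Σ; _×_; _,_; proj₁)
open import Data.Sum using (inj₁; inj₂)
open import Relation.Binary.PropositionalEquality
open ≡-Reasoning

data Parity : ℕ → Set where
  even : ∀ c → Parity (c * 2)
  odd  : ∀ c → Parity (suc (c * 2))

parity : ∀ n → Parity n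
parity zero = even 0
parity (suc n) with parity n
... | even c = odd c
... | odd c  = even (suc c)

n<2^n : ∀ n → n < 2 ^ n
n<2^n zero    = z<s
n<2^n (suc n) = subst (suc n <_) (cong (2 ^ n +_) (sym (+-identityʳ (2 ^ n))))
  (+-mono-≤ (m^n>0 2 n) (n<2^n n))

half-binary : ∀ {x} c → x < 2 → (x + c * 2) / 2 ≡ c
half-binary {x} c x<2 = begin
  (x + c * 2) / 2     ≡⟨ +-distrib-/-∣ʳ x (divides-refl c) ⟩
  x / 2 + c * 2 / 2   ≡⟨ cong₂ _+_ (m<n⇒m/n≡0 x<2) (m*n/n≡m c 2) ⟩
  c                   ∎

bitℕ-zero-binary : ∀ {x} c → x < 2 → bitℕ 0 (x + c * 2) ≡ x
bitℕ-zero-binary {x} c x<2 = begin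
  bitℕ 0 (x + c * 2)   ≡⟨ cong (_% 2) (n/1≡n (x + c * 2)) ⟩
  (x + c * 2) % 2      ≡⟨ [m+kn]%n≡m%n x c 2 ⟩
  x % 2                ≡⟨ m<n⇒m%n≡m x<2 ⟩
  x                    ∎

bitℕ-suc : ∀ q n → bitℕ (suc q) n ≡ bitℕ q (n / 2)
bitℕ-suc q n =
  cong (_% 2) (sym (m/n/o≡m/[n*o] n 2 (2 ^ q) ⦃ _ ⦄ ⦃ m^n≢0 2 q ⦄ ⦃ m^n≢0 2 (suc q) ⦄))

bitℕ-≥ : ∀ {q n} → n ≤ q → bitℕ q n ≡ 0
bitℕ-≥ {q} {n} n≤q =
  cong (_% 2) (m<n⇒m/n≡0 ⦃ m^n≢0 2 q ⦄ (<-≤-trans (n<2^n n) (^-monoʳ-≤ 2 n≤q)))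

bit-suc : ∀ q n → bit (suc q) n ≡ bit q (n / 2)
bit-suc q n = cong (_≡ᵇ 1) (bitℕ-suc q n)

bit-≥ : ∀ {q n} → n ≤ q → bit q n ≡ false
bit-≥ n≤q = cong (_≡ᵇ 1) (bitℕ-≥ n≤q)

sumBelow-cong : ∀ K {f g} → (∀ q → f q ≡ g q) → sumBelow K f ≡ sumBelow K g
sumBelow-cong zero    f≗g = refl
sumBelow-cong (suc K) f≗g = cong₂ _+_ (sumBelow-cong K f≗g) (f≗g K)

sumBelow-shift : ∀ K f → sumBelow (suc K) f ≡ f 0 + sumBelow K (λ q → f (suc q))
sumBelow-shift zero    f = sym (+-identityʳ (f 0))
sumBelow-shift (suc K) f =
  trans (cong (_+ f (suc K)) (sumBelow-shift K f)) (+-assoc (f 0) _ (f (suc K)))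

*-distribʳ-sumBelow : ∀ d K f → sumBelow K f * d ≡ sumBelow K (λ q → f q * d)
*-distribʳ-sumBelow d zero    f = refl
*-distribʳ-sumBelow d (suc K) f =
  trans (*-distribʳ-+ d (sumBelow K f) (f K)) (cong (_+ f K * d) (*-distribʳ-sumBelow d K f))

sumBelow-stable : ∀ {n f} → (∀ q → n ≤ q → f q ≡ 0) → ∀ K → n ≤ K → sumBelow K f ≡ sumBelow n f
sumBelow-stable vanish zero    z≤n = refl
sumBelow-stable {f = f} vanish (suc K) n≤K with m≤n⇒m<n∨m≡n n≤K
... | inj₂ refl = refl
... | inj₁ (s≤s n≤K′) =
  trans (cong (sumBelow K f +_) (vanish K n≤K′))
        (trans (+-identityʳ _) (sumBelow-stable vanish K n≤K′))

xorBelow-cong : ∀ K {f g} → (∀ q → f q ≡ g q) → xorBelow K f ≡ xorBelow K g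
xorBelow-cong zero    f≗g = refl
xorBelow-cong (suc K) f≗g = cong₂ _xor_ (xorBelow-cong K f≗g) (f≗g K)

xorBelow-shift : ∀ K f → xorBelow (suc K) f ≡ f 0 xor xorBelow K (λ q → f (suc q))
xorBelow-shift zero    f = sym (xor-identityʳ (f 0))
xorBelow-shift (suc K) f =
  trans (cong (_xor f (suc K)) (xorBelow-shift K f)) (xor-assoc (f 0) _ (f (suc K)))

xorBelow-xor : ∀ K f g → xorBelow K (λ q → f q xor g q) ≡ xorBelow K f xor xorBelow K g
xorBelow-xor zero    f g = refl
xorBelow-xor (suc K) f g =
  trans (cong (_xor (f K xor g K)) (xorBelow-xor K f g)) (interchange (xorBelow K f) _ (f K) _)

xorBelow-stable : ∀ {n f} → (∀ q → n ≤ q → f q ≡ false) → ∀ K → n ≤ K → xorBelow K f ≡ xorBelow n f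
xorBelow-stable vanish zero    z≤n = refl
xorBelow-stable {f = f} vanish (suc K) n≤K with m≤n⇒m<n∨m≡n n≤K
... | inj₂ refl = refl
... | inj₁ (s≤s n≤K′) =
  trans (cong (xorBelow K f xor_) (vanish K n≤K′))
        (trans (xor-identityʳ _) (xorBelow-stable vanish K n≤K′))

&-half : ∀ p m → p & m ≡ bitℕ 0 p * bitℕ 0 m + ((p / 2) & (m / 2)) * 2
&-half p m = begin
  p & m                                      ≡⟨ sumBelow-shift p term ⟩
  term 0 + sumBelow p (λ q → term (suc q))   ≡⟨ cong₂ _+_ (*-identityˡ b₀) (sumBelow-cong p term-suc) ⟩
  b₀ + sumBelow p (λ q → half-term q * 2)    ≡⟨ cong (b₀ +_) (*-distribʳ-sumBelow 2 p half-term) ⟨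
  b₀ + sumBelow p half-term * 2              ≡⟨ cong (λ s → b₀ + s * 2) truncate ⟩
  b₀ + ((p / 2) & (m / 2)) * 2               ∎
  where
  b₀ : ℕ
  b₀ = bitℕ 0 p * bitℕ 0 m

  term half-term : ℕ → ℕ
  term q      = 2 ^ q * (bitℕ q p * bitℕ q m)
  half-term q = 2 ^ q * (bitℕ q (p / 2) * bitℕ q (m / 2))

  term-suc : ∀ q → term (suc q) ≡ half-term q * 2
  term-suc q = begin
    2 * 2 ^ q * (bitℕ (suc q) p * bitℕ (suc q) m)
      ≡⟨ cong₂ (λ x y → 2 * 2 ^ q * (x * y)) (bitℕ-suc q p) (bitℕ-suc q m) ⟩
    2 * 2 ^ q * (bitℕ q (p / 2) * bitℕ q (m / 2))   ≡⟨ *-assoc 2 (2 ^ q) _ ⟩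
    2 * half-term q                                 ≡⟨ *-comm 2 (half-term q) ⟩
    half-term q * 2                                 ∎

  half-term-vanishes : ∀ q → p / 2 ≤ q → half-term q ≡ 0
  half-term-vanishes q p/2≤q =
    trans (cong (λ x → 2 ^ q * (x * bitℕ q (m / 2))) (bitℕ-≥ p/2≤q)) (*-zeroʳ (2 ^ q))

  truncate : sumBelow p half-term ≡ sumBelow (suc (p / 2)) half-term
  truncate = trans (sumBelow-stable half-term-vanishes p (m/n≤m p 2))
                   (sym (sumBelow-stable half-term-vanishes (suc (p / 2)) (n≤1+n (p / 2))))

&-binary : ∀ {x y} c a → x < 2 → y < 2 → (x + c * 2) & (y + a * 2) ≡ x * y + (c & a) * 2
&-binary {x} {y} c a x<2 y<2 = trans (&-half (x + c * 2) (y + a * 2))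
  (cong₂ _+_ (cong₂ _*_ (bitℕ-zero-binary c x<2) (bitℕ-zero-binary a y<2))
             (cong (_* 2) (cong₂ _&_ (half-binary c x<2) (half-binary a y<2))))

disjoint : ℕ → ℕ → Bool
disjoint p m = (p & m) ≡ᵇ 0

disjoint-zeroʳ : ∀ p → disjoint p 0 ≡ true
disjoint-zeroʳ p = cong (_≡ᵇ 0) (sumBelow-stable vanish (suc p) z≤n)
  where
  vanish : ∀ q → 0 ≤ q → 2 ^ q * (bitℕ q p * bitℕ q 0) ≡ 0
  vanish q _ = trans (cong (λ x → 2 ^ q * (bitℕ q p * x)) (bitℕ-≥ {q} z≤n))
                     (trans (cong (2 ^ q *_) (*-zeroʳ (bitℕ q p))) (*-zeroʳ (2 ^ q)))

*2≡ᵇ0 : ∀ z → (z * 2 ≡ᵇ 0) ≡ (z ≡ᵇ 0)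
*2≡ᵇ0 zero    = refl
*2≡ᵇ0 (suc z) = refl

disjoint-even-even : ∀ c a → disjoint (c * 2) (a * 2) ≡ disjoint c a
disjoint-even-even c a = trans (cong (_≡ᵇ 0) (&-binary c a z<s z<s)) (*2≡ᵇ0 (c & a))

disjoint-even-odd : ∀ c a → disjoint (c * 2) (suc (a * 2)) ≡ disjoint c a
disjoint-even-odd c a = trans (cong (_≡ᵇ 0) (&-binary c a z<s (s<s z<s))) (*2≡ᵇ0 (c & a))

disjoint-odd-even : ∀ c a → disjoint (suc (c * 2)) (a * 2) ≡ disjoint c a
disjoint-odd-even c a = trans (cong (_≡ᵇ 0) (&-binary c a (s<s z<s) z<s)) (*2≡ᵇ0 (c & a))

disjoint-odd-odd : ∀ c a → disjoint (suc (c * 2)) (suc (a * 2)) ≡ false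
disjoint-odd-odd c a = cong (_≡ᵇ 0) (&-binary c a (s<s z<s) (s<s z<s))

disjoint-pascal : ∀ q m → disjoint (suc q) (suc m) ≡ disjoint q (suc m) xor disjoint (suc q) m
disjoint-pascal = <-rec PascalAt pascal
  where
  PascalAt : ℕ → Set
  PascalAt q = ∀ m → disjoint (suc q) (suc m) ≡ disjoint q (suc m) xor disjoint (suc q) m

  pascal : ∀ q → (∀ {r} → r < q → PascalAt r) → PascalAt q
  pascal q ih m with parity q | parity m
  ... | even c | even a = begin
    disjoint (suc (c * 2)) (suc (a * 2))
      ≡⟨ disjoint-odd-odd c a ⟩
    false
      ≡⟨ xor-same (disjoint c a) ⟨
    disjoint c a xor disjoint c a
      ≡⟨ cong₂ _xor_ (disjoint-even-odd c a) (disjoint-odd-even c a) ⟨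
    disjoint (c * 2) (suc (a * 2)) xor disjoint (suc (c * 2)) (a * 2) ∎
  ... | even c | odd a = begin
    disjoint (suc (c * 2)) (suc a * 2)
      ≡⟨ disjoint-odd-even c (suc a) ⟩
    disjoint c (suc a)
      ≡⟨ xor-identityʳ (disjoint c (suc a)) ⟨
    disjoint c (suc a) xor false
      ≡⟨ cong₂ _xor_ (disjoint-even-even c (suc a)) (disjoint-odd-odd c a) ⟨
    disjoint (c * 2) (suc a * 2) xor disjoint (suc (c * 2)) (suc (a * 2)) ∎
  ... | odd c | even a = begin
    disjoint (suc c * 2) (suc (a * 2))
      ≡⟨ disjoint-even-odd (suc c) a ⟩
    disjoint (suc c) a
      ≡⟨ cong₂ _xor_ (disjoint-odd-odd c a) (disjoint-even-even (suc c) a) ⟨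
    disjoint (suc (c * 2)) (suc (a * 2)) xor disjoint (suc c * 2) (a * 2) ∎
  ... | odd c | odd a = begin
    disjoint (suc c * 2) (suc a * 2)
      ≡⟨ disjoint-even-even (suc c) (suc a) ⟩
    disjoint (suc c) (suc a)
      ≡⟨ ih (s<s (m≤m*n c 2)) a ⟩
    disjoint c (suc a) xor disjoint (suc c) a
      ≡⟨ cong₂ _xor_ (disjoint-odd-even c (suc a)) (disjoint-even-odd (suc c) a) ⟨
    disjoint (suc (c * 2)) (suc a * 2) xor disjoint (suc c * 2) (suc (a * 2)) ∎

select : (ℕ → Bool) → ℕ → ℕ → Bool
select S n p = if S p then bit p n else false

if-then-false-xor : ∀ b c x →
  (if b xor c then x else false) ≡ (if b then x else false) xor (if c then x else false)
if-then-false-xor false c     x = refl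
if-then-false-xor true  false x = sym (xor-identityʳ x)
if-then-false-xor true  true  x = sym (xor-same x)

selectedParity : (ℕ → Bool) → ℕ → Bool
selectedParity S n = xorBelow (suc n) (select S n)

selectedParity-cong : ∀ {S S′} → (∀ p → S p ≡ S′ p) → ∀ n → selectedParity S n ≡ selectedParity S′ n
selectedParity-cong S≗S′ n = xorBelow-cong (suc n) (λ p → if-cong (S≗S′ p))

selectedParity-xor : ∀ S S′ n →
  selectedParity (λ p → S p xor S′ p) n ≡ selectedParity S n xor selectedParity S′ n
selectedParity-xor S S′ n =
  trans (xorBelow-cong (suc n) (λ p → if-then-false-xor (S p) (S′ p) (bit p n)))
        (xorBelow-xor (suc n) _ _)

selectedParity-half : ∀ S n →
  selectedParity S n ≡ select S n 0 xor selectedParity (λ p → S (suc p)) (n / 2)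
selectedParity-half S n = begin
  xorBelow (suc n) (select S n)
    ≡⟨ xorBelow-shift n (select S n) ⟩
  select S n 0 xor xorBelow n (λ p → select S n (suc p))
    ≡⟨ cong (select S n 0 xor_) (xorBelow-cong n (λ p → if-cong-then (S (suc p)) (bit-suc p n))) ⟩
  select S n 0 xor xorBelow n (select S⁺ (n / 2))
    ≡⟨ cong (select S n 0 xor_) truncate ⟩
  select S n 0 xor xorBelow (suc (n / 2)) (select S⁺ (n / 2)) ∎
  where
  S⁺ : ℕ → Bool
  S⁺ p = S (suc p)

  vanish : ∀ q → n / 2 ≤ q → select S⁺ (n / 2) q ≡ false
  vanish q n/2≤q = trans (if-cong-then (S⁺ q) (bit-≥ n/2≤q)) (if-eta (S⁺ q))

  truncate : xorBelow n (select S⁺ (n / 2)) ≡ xorBelow (suc (n / 2)) (select S⁺ (n / 2))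
  truncate = trans (xorBelow-stable vanish n (m/n≤m n 2))
                   (sym (xorBelow-stable vanish (suc (n / 2)) (n≤1+n (n / 2))))

xorFormula-half : ∀ m k →
  xorFormula m k ≡ bit 0 k xor selectedParity (λ p → disjoint (suc p) m) (k / 2)
-- Position 0 is selected because disjoint 0 m reduces to true.
xorFormula-half m = selectedParity-half (λ p → disjoint p m)

xorFormula-suc : ∀ m k → xorFormula (suc m) k ≡ xorFormula (suc m) (k / 2) xor xorFormula m k
xorFormula-suc m k = begin
  xorFormula (suc m) k
    ≡⟨ xorFormula-half (suc m) k ⟩
  bit 0 k xor selectedParity (λ p → disjoint (suc p) (suc m)) (k / 2)
    ≡⟨ cong (bit 0 k xor_) (trans (selectedParity-cong (λ p → disjoint-pascal p m) (k / 2))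
                                  (selectedParity-xor _ _ (k / 2))) ⟩
  bit 0 k xor (xorFormula (suc m) (k / 2) xor P (k / 2))
    ≡⟨ x∙yz≈y∙xz (bit 0 k) (xorFormula (suc m) (k / 2)) (P (k / 2)) ⟩
  xorFormula (suc m) (k / 2) xor (bit 0 k xor P (k / 2))
    ≡⟨ cong (xorFormula (suc m) (k / 2) xor_) (xorFormula-half m k) ⟨
  xorFormula (suc m) (k / 2) xor xorFormula m k ∎
  where
  P : ℕ → Bool
  P = selectedParity (λ p → disjoint (suc p) m)

Alternating : (ℕ → Bool) → Set
Alternating σ = ∀ c → σ (suc (c * 2)) ≡ not (σ (c * 2))

xorFormula-alternating : ∀ m → Alternating (xorFormula m)
xorFormula-alternating m c = begin
  xorFormula m (suc (c * 2))
    ≡⟨ xorFormula-half m (suc (c * 2)) ⟩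
  bit 0 (1 + c * 2) xor P ((1 + c * 2) / 2)
    ≡⟨ cong₂ _xor_ (cong (_≡ᵇ 1) (bitℕ-zero-binary c (s<s z<s))) (cong P (half-binary c (s<s z<s))) ⟩
  not (P c)
    ≡⟨ cong not (cong₂ _xor_ (cong (_≡ᵇ 1) (bitℕ-zero-binary c z<s)) (cong P (half-binary c z<s))) ⟨
  not (bit 0 (c * 2) xor P (c * 2 / 2))
    ≡⟨ cong not (xorFormula-half m (c * 2)) ⟨
  not (xorFormula m (c * 2)) ∎
  where
  P : ℕ → Bool
  P = selectedParity (λ p → disjoint (suc p) m)

isOdd : ℕ → Bool
isOdd n = n % 2 ≡ᵇ 1

isOdd-suc : ∀ n → isOdd (suc n) ≡ not (isOdd n)
isOdd-suc zero          = refl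
isOdd-suc (suc zero)    = refl
isOdd-suc (suc (suc n)) = isOdd-suc n

isOdd-+ : ∀ m n → isOdd (m + n) ≡ isOdd m xor isOdd n
isOdd-+ zero    n = refl
isOdd-+ (suc m) n = begin
  isOdd (suc (m + n))           ≡⟨ isOdd-suc (m + n) ⟩
  not (isOdd (m + n))           ≡⟨ cong not (isOdd-+ m n) ⟩
  not (isOdd m xor isOdd n)     ≡⟨ not-distribˡ-xor (isOdd m) (isOdd n) ⟩
  not (isOdd m) xor isOdd n     ≡⟨ cong (_xor isOdd n) (isOdd-suc m) ⟨
  isOdd (suc m) xor isOdd n     ∎

isOdd-sumBelow : ∀ K f → isOdd (sumBelow K f) ≡ xorBelow K (λ p → isOdd (f p))
isOdd-sumBelow zero    f = refl
isOdd-sumBelow (suc K) f =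
  trans (isOdd-+ (sumBelow K f) (f K)) (cong (_xor isOdd (f K)) (isOdd-sumBelow K f))

t≡xorFormula-zero : ∀ n → t n ≡ xorFormula 0 n
t≡xorFormula-zero n = begin
  isOdd (sumBelow (suc n) (λ p → bitℕ p n))
    ≡⟨ isOdd-sumBelow (suc n) (λ p → bitℕ p n) ⟩
  xorBelow (suc n) (λ p → isOdd (bitℕ p n))
    ≡⟨ xorBelow-cong (suc n) (λ p → cong (_≡ᵇ 1) (m%n%n≡m%n (_/_ n (2 ^ p) ⦃ m^n≢0 2 p ⦄) 2)) ⟩
  xorBelow (suc n) (λ p → bit p n)
    ≡⟨ xorBelow-cong (suc n) (λ p → if-cong (disjoint-zeroʳ p)) ⟨
  xorFormula 0 n ∎

-- τ k is the xor of σ along the binary prefixes k, ⌊k/2⌋, ⌊k/4⌋, … of k.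
IsPrefixXor : (ℕ → Bool) → (ℕ → Bool) → Set
IsPrefixXor σ τ = τ 0 ≡ false × (∀ k → τ k ≡ τ (k / 2) xor σ k)

xorFormula-isPrefixXor : ∀ m → IsPrefixXor (xorFormula m) (xorFormula (suc m))
xorFormula-isPrefixXor m = refl , xorFormula-suc m

prefixXor-unique : ∀ {σ τ τ′} → IsPrefixXor σ τ → IsPrefixXor σ τ′ → ∀ k → τ k ≡ τ′ k
prefixXor-unique {σ} {τ} {τ′} (τ0 , τ-rec) (τ′0 , τ′-rec) = <-rec (λ k → τ k ≡ τ′ k) agree
  where
  agree : ∀ k → (∀ {j} → j < k → τ j ≡ τ′ j) → τ k ≡ τ′ k
  agree zero    _  = trans τ0 (sym τ′0)
  agree (suc k) ih = begin
    τ (suc k)                      ≡⟨ τ-rec (suc k) ⟩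
    τ (suc k / 2) xor σ (suc k)    ≡⟨ cong (_xor σ (suc k)) (ih (m/n<m (suc k) 2 (s<s z<s))) ⟩
    τ′ (suc k / 2) xor σ (suc k)   ≡⟨ τ′-rec (suc k) ⟨
    τ′ (suc k)                     ∎

indicator : Bool → Bool → ℕ
indicator x b = if eqB x b then 1 else 0

indicator-+-not : ∀ x b → indicator x b + indicator (not x) b ≡ 1
indicator-+-not false false = refl
indicator-+-not false true  = refl
indicator-+-not true  false = refl
indicator-+-not true  true  = refl

indicator-not : ∀ x → indicator x (not x) ≡ 0
indicator-not false = refl
indicator-not true  = refl

countBefore-pairs : ∀ {σ} → Alternating σ → ∀ b c → countBefore σ b (c * 2) ≡ c
countBefore-pairs     alt b zero    = refl
countBefore-pairs {σ} alt b (suc c) = begin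
  countBefore σ b (c * 2) + indicator (σ (c * 2)) b + indicator (σ (suc (c * 2))) b
    ≡⟨ cong₂ (λ n y → n + indicator x b + indicator y b) (countBefore-pairs alt b c) (alt c) ⟩
  c + indicator x b + indicator (not x) b
    ≡⟨ +-assoc c (indicator x b) (indicator (not x) b) ⟩
  c + (indicator x b + indicator (not x) b)
    ≡⟨ cong (c +_) (indicator-+-not x b) ⟩
  c + 1
    ≡⟨ +-comm c 1 ⟩
  suc c ∎
  where
  x : Bool
  x = σ (c * 2)

countBefore-alternating : ∀ {σ} → Alternating σ → ∀ k → countBefore σ (σ k) k ≡ k / 2
countBefore-alternating {σ} alt k with parity k
... | even c = trans (countBefore-pairs alt (σ (c * 2)) c) (sym (half-binary c z<s))
... | odd c  = begin
  countBefore σ (σ (suc (c * 2))) (c * 2) + indicator (σ (c * 2)) (σ (suc (c * 2)))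
    ≡⟨ cong₂ _+_ (countBefore-pairs alt _ c) (cong (indicator (σ (c * 2))) (alt c)) ⟩
  c + indicator (σ (c * 2)) (not (σ (c * 2)))
    ≡⟨ cong (c +_) (indicator-not (σ (c * 2))) ⟩
  c + 0
    ≡⟨ +-identityʳ c ⟩
  c
    ≡⟨ half-binary c (s<s z<s) ⟨
  suc (c * 2) / 2 ∎

isTMTransform-intro : ∀ {σ τ} → τ 0 ≡ false →
  (∀ k → τ k ≡ τ (countBefore σ (σ k) k) xor σ k) → IsTMTransform σ τ
isTMTransform-intro {σ} {τ} τ0 τ-rec = τ0 , at-false , at-true
  where
  τ-rec-at : ∀ {b} k → σ k ≡ b → τ k ≡ τ (countBefore σ b k) xor b
  τ-rec-at k refl = τ-rec k

  at-false : ∀ k → σ k ≡ false → τ k ≡ τ (countBefore σ false k)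
  at-false k σk = trans (τ-rec-at k σk) (xor-identityʳ _)

  at-true : ∀ k → σ k ≡ true → τ k ≡ not (τ (countBefore σ true k))
  at-true k σk = trans (τ-rec-at k σk) (xor-comm _ true)

isTMTransform-elim : ∀ {σ τ} → IsTMTransform σ τ →
  ∀ k → τ k ≡ τ (countBefore σ (σ k) k) xor σ k
isTMTransform-elim {σ} (_ , at-false , at-true) k with σ k in σk
... | false = trans (at-false k σk) (sym (xor-identityʳ _))
... | true  = trans (at-true k σk) (xor-comm true _)

prefixXor⇒isTMTransform : ∀ {σ τ} → Alternating σ → IsPrefixXor σ τ → IsTMTransform σ τ
prefixXor⇒isTMTransform {σ} {τ} alt (τ0 , τ-rec) = isTMTransform-intro τ0 λ k →
  trans (τ-rec k) (cong (λ j → τ j xor σ k) (sym (countBefore-alternating alt k)))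

isTMTransform⇒prefixXor : ∀ {σ τ} → Alternating σ → IsTMTransform σ τ → IsPrefixXor σ τ
isTMTransform⇒prefixXor {σ} {τ} alt tm = proj₁ tm , λ k →
  trans (isTMTransform-elim tm k) (cong (λ j → τ j xor σ k) (countBefore-alternating alt k))

xorFormula-isTower : IsTower xorFormula
xorFormula-isTower = (λ n → sym (t≡xorFormula-zero n)) , λ m →
  prefixXor⇒isTMTransform (xorFormula-alternating m) (xorFormula-isPrefixXor m)

tower-unique : (a : ℕ → ℕ → Bool) → IsTower a → (m n : ℕ) → a m n ≡ xorFormula m n
tower-unique a (a0 , _) zero n = trans (a0 n) (t≡xorFormula-zero n)
tower-unique a tower@(_ , a-step) (suc m) =
  prefixXor-unique (isTMTransform⇒prefixXor alternating (a-step m)) formula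
  where
  ih : ∀ n → a m n ≡ xorFormula m n
  ih = tower-unique a tower m

  alternating : Alternating (a m)
  alternating c = trans (ih (suc (c * 2)))
    (trans (xorFormula-alternating m c) (cong not (sym (ih (c * 2)))))

  formula : IsPrefixXor (a m) (xorFormula (suc m))
  formula = refl , λ k →
    trans (xorFormula-suc m k) (cong (xorFormula (suc m) (k / 2) xor_) (sym (ih k)))

theorem5 : Σ (ℕ → ℕ → Bool) IsTower
    × ((a : ℕ → ℕ → Bool) → IsTower a → (m n : ℕ) → a m n ≡ xorFormula m n)
theorem5 = (xorFormula , xorFormula-isTower) , tower-unique
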